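{- Assume the abc conjecture. Then there exist only finitely many twin exceptional autonomous components (over all Goldbach factorization graphs $F_n$, $n\ge 4$ even).
   Context: For an even integer $n\ge 4$, the Goldbach factorization graph is the directed weighted graph $F_n=(V_n,A_n,w_n)$ with vertex set $V_n=[2,n-2]\cap\mathbb{P}$ ($\mathbb{P}$ the set of primes), arc set $A_n=\{(s,t)\in V_n^2 : s \mid (n-t)\}$ (loops allowed), and weights $w_n((s,t))=\max\{e\ge 1: s^e\mid (n-t)\}$. An autonomous component of $F_n$ is a minimal (with respect to inclusion) nonempty subgraph of $F_n$ induced by a vertex set $U\subseteq V_n$ such that $(s,t)\notin A_n$ for every $s\in V_n\setminus U$ and $t\in U$. A Goldbach autonomous component (GAC) is an autonomous component induced by vertices $v_1,v_2\in V_n$ with $v_1+v_2=n$ (a single vertex if $v_1=v_2$). A trivial autonomous component (TAC) is an autonomous component induced by a single vertex that is not a GAC. An exceptional autonomous component (EAC) is an autonomous component that is neither a TAC nor a GAC. A twin EAC is an EAC induced by exactly two vertices. -}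

module Defs where

open import Level using (0ℓ)
open import Data.Nat using (ℕ; suc; _+_; _*_; _∸_; _^_; _≤_; _<_)
open import Data.Nat.Divisibility using (_∣_; _∣?_)
open import Data.Nat.Primality using (Prime; prime?)
open import Data.Nat.Coprimality using (Coprime)
open import Data.List using (List; filter; upTo)
open import Data.Nat.ListAction using (product)
open import Data.Product using (Σ; ∃; _×_; _,_)
open import Data.Sum using (_⊎_)
open import Relation.Nullary using (¬_)
open import Relation.Nullary.Decidable using (_×-dec_)
open import Relation.Binary.PropositionalEquality using (_≡_; _≢_)
open import Relation.Unary using (Pred)
open import Function.Bundles using (_⇔_)

rad : ℕ → ℕ
rad m = product (filter (λ p → prime? p ×-dec (p ∣? m)) (upTo (ℕ.suc m)))
  where open Data.Nat

-- abc conjecture: for every rational ε = p/q > 0 there are only finitely many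
-- triples of coprime positive a, b with a + b = c and c > rad(abc)^(1+ε),
-- i.e. c^q > rad(abc)^(q+p); finiteness = bounded c.
ABC : Set
ABC = ∀ (p q : ℕ) → 0 < p → 0 < q →
      ∃ λ B → ∀ (a b c : ℕ) → 0 < a → 0 < b → a + b ≡ c → Coprime a b →
        rad (a * b * c) ^ (q + p) < c ^ q → c < B

Vertex : ℕ → ℕ → Set
Vertex n p = Prime p × 2 ≤ p × p ≤ n ∸ 2

Arc : ℕ → ℕ → ℕ → Set
Arc n s t = Vertex n s × Vertex n t × s ∣ (n ∸ t)

Closed : ℕ → Pred ℕ 0ℓ → Set
Closed n U = (∀ x → U x → Vertex n x) ×
             (∀ s t → Arc n s t → U t → U s)

NonEmpty : Pred ℕ 0ℓ → Set
NonEmpty U = ∃ λ x → U x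

AutonomousComponent : ℕ → Pred ℕ 0ℓ → Set₁
AutonomousComponent n U =
  Closed n U × NonEmpty U ×
  (∀ (W : Pred ℕ 0ℓ) → Closed n W → NonEmpty W →
     (∀ x → W x → U x) → ∀ x → U x → W x)

InducedBy : Pred ℕ 0ℓ → ℕ → ℕ → Set
InducedBy U v₁ v₂ = ∀ x → U x ⇔ (x ≡ v₁ ⊎ x ≡ v₂)

GAC : ℕ → Pred ℕ 0ℓ → Set₁
GAC n U = AutonomousComponent n U ×
          (∃ λ v₁ → ∃ λ v₂ → v₁ + v₂ ≡ n × InducedBy U v₁ v₂)

TAC : ℕ → Pred ℕ 0ℓ → Set₁
TAC n U = AutonomousComponent n U × (∃ λ v → InducedBy U v v) × ¬ GAC n U

EAC : ℕ → Pred ℕ 0ℓ → Set₁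
EAC n U = AutonomousComponent n U × ¬ TAC n U × ¬ GAC n U

TwinEAC : ℕ → Pred ℕ 0ℓ → Set₁
TwinEAC n U = EAC n U × (∃ λ u → ∃ λ v → u ≢ v × InducedBy U u v)

{-# OPTIONS --safe #-}
-- Let {u, v} be a twin exceptional component of F_n. Closedness puts every prime
-- factor of n − u and of n − v into {u, v}, and minimality (neither {u} nor {v} is
-- closed) forces v ∣ n − u and u ∣ n − v.  Hence n − u = v^b and n − v = u^c, with
-- b, c ≥ 2 because b = 1 would make the component Goldbach; n is even, so u, v are
-- odd, and for u < v also b < c.  For b ≥ 3 the abc triple u^c + (v − u) = v^b has
-- radical at most u v², and (u v²)^12 < (v^b)^11; for b = 2, c ≥ 5 the triple
-- (4u − 1) + (2v − 1)² = 4u^c has radical at most 16 u² v, and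
-- (16 u² v)^20 < (4u^c)^19 once u^c ≥ 2^53.  So abc with ε = 1/11 and ε = 1/19
-- bounds v^b, hence n = v^b + u; the cases (b, c) = (2, 3), (2, 4) have no solutions.
module Submission where

open import Defs
open import Level using (0ℓ)
open import Data.Nat.Base
open import Data.Nat.Properties
open import Data.Nat.Divisibility
open import Data.Nat.Primality
open import Data.Nat.Primality.Factorisation
  using (factorise; PrimeFactorisation; factorisationHasAllPrimeFactors)
open import Data.Nat.Coprimality using (Coprime)
open import Data.Nat.Tactic.RingSolver using (solve-∀)
open import Data.Nat.Solver using (module +-*-Solver)
open +-*-Solver using (solve; _:+_; _:*_; _:^_; _:=_; con)
open import Data.Nat.ListAction using (product)
open import Data.List.Base using ([]; _∷_; filter; upTo; length)
open import Data.List.Relation.Unary.All as All using (All; []; _∷_)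
open import Data.List.Relation.Unary.All.Properties using (all-filter; All¬⇒¬Any)
open import Data.List.Relation.Unary.AllPairs using (_∷_)
open import Data.List.Relation.Unary.Unique.Propositional using (Unique)
open import Data.List.Relation.Unary.Unique.Propositional.Properties using (filter⁺; upTo⁺)
open import Data.Product using (∃; _×_; _,_; proj₁; proj₂)
open import Data.Sum using (inj₁; inj₂; [_,_]′; swap)
open import Data.Empty using (⊥-elim)
open import Function using (_∘_)
open import Function.Bundles using (Equivalence; mk⇔)
open import Relation.Nullary using (¬_; Dec; yes; no)
open import Relation.Nullary.Decidable using (_×-dec_)
open import Relation.Unary using (Pred; Decidable)
open import Relation.Binary.Definitions using (tri<; tri≈; tri>)
open import Relation.Binary.PropositionalEquality

private
  variable
    m n k p : ℕ
    P : Pred ℕ 0ℓ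

prime⇒≢1 : Prime p → p ≢ 1
prime⇒≢1 pp = nonTrivial⇒≢1 {{prime⇒nonTrivial pp}}

prime⇒≥2 : Prime p → 2 ≤ p
prime⇒≥2 pp = nonTrivial⇒n>1 _ {{prime⇒nonTrivial pp}}

prime∣prime⇒≡ : ∀ {q} → Prime p → Prime q → p ∣ q → p ≡ q
prime∣prime⇒≡ pp pq p∣q with prime⇒irreducible pq p∣q
... | inj₁ p≡1 = ⊥-elim (prime⇒≢1 pp p≡1)
... | inj₂ p≡q = p≡q

∃prime∣ : ∀ m → .{{NonZero m}} → m ≢ 1 → ∃ λ p → Prime p × p ∣ m
∃prime∣ m m≢1 with factorise m
... | record { factors = [] ; isFactorisation = m≡1 } = ⊥-elim (m≢1 m≡1)
... | record { factors = p ∷ ps ; isFactorisation = m≡Π ; factorsPrime = pp ∷ _ } =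
  p , pp , subst (p ∣_) (sym m≡Π) (m∣m*n (product ps))

PrimeDivisorsIn : ℕ → Pred ℕ 0ℓ → Set
PrimeDivisorsIn m P = ∀ {p} → Prime p → p ∣ m → P p

∣⇒primeDivisorsIn : m ∣ n → PrimeDivisorsIn m (_∣ n)
∣⇒primeDivisorsIn m∣n _ p∣m = ∣-trans p∣m m∣n

primeDivisorsIn-* : PrimeDivisorsIn m P → PrimeDivisorsIn n P → PrimeDivisorsIn (m * n) P
primeDivisorsIn-* {m} {n = n} ⊆m ⊆n pp p∣mn = [ ⊆m pp , ⊆n pp ]′ (euclidsLemma m n pp p∣mn)

primeDivisorsIn-^ : ∀ k → PrimeDivisorsIn m P → PrimeDivisorsIn (m ^ k) P
primeDivisorsIn-^ zero    _  pp p∣1 = ⊥-elim (prime⇒≢1 pp (∣1⇒≡1 p∣1))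
primeDivisorsIn-^ (suc k) ⊆m = primeDivisorsIn-* ⊆m (primeDivisorsIn-^ k ⊆m)

primeDivisorsIn-prime : Prime p → PrimeDivisorsIn p (_≡ p)
primeDivisorsIn-prime pp pq q∣p = prime∣prime⇒≡ pq pp q∣p

noCommonPrime⇒coprime : ∀ m n → .{{NonZero m}} → PrimeDivisorsIn m (λ p → ¬ p ∣ n) → Coprime m n
noCommonPrime⇒coprime m n _ {0} (0∣m , _) = ⊥-elim (≢-nonZero⁻¹ m (0∣⇒≡0 0∣m))
noCommonPrime⇒coprime m n _ {1} _ = refl
noCommonPrime⇒coprime m n disjoint {i@(2+ _)} (i∣m , i∣n) with ∃prime∣ i (λ ())
... | p , pp , p∣i = ⊥-elim (disjoint pp (∣-trans p∣i i∣m) (∣-trans p∣i i∣n))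

product≡^length : ∀ {v} ps → All Prime ps → PrimeDivisorsIn (product ps) (_≡ v) →
                  product ps ≡ v ^ length ps
product≡^length []       []         _ = refl
product≡^length (p ∷ ps) (pp ∷ pps) ⊆v =
  cong₂ _*_ (⊆v pp (m∣m*n (product ps)))
            (product≡^length ps pps (λ pq q∣Π → ⊆v pq (∣-trans q∣Π (n∣m*n p))))

primeDivisorsIn≡⇒power : ∀ {v} m → .{{NonZero m}} → PrimeDivisorsIn m (_≡ v) → ∃ λ b → m ≡ v ^ b
primeDivisorsIn≡⇒power m ⊆v =
  length ps , trans m≡Π (product≡^length ps factorsPrime (subst (λ x → PrimeDivisorsIn x _) m≡Π ⊆v))
  where
  open PrimeFactorisation (factorise m) renaming (factors to ps; isFactorisation to m≡Π)

uniquePrimes⇒product∣ : ∀ ps → Unique ps → All Prime ps → All (_∣ n) ps → product ps ∣ n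
uniquePrimes⇒product∣ []       _            _          _            = 1∣ _
uniquePrimes⇒product∣ (p ∷ ps) (p∉ps ∷ ps!) (pp ∷ pps) (p∣n ∷ ps∣n)
  with uniquePrimes⇒product∣ ps ps! pps ps∣n
... | divides q n≡qΠ with euclidsLemma q (product ps) pp (subst (p ∣_) n≡qΠ p∣n)
...   | inj₁ p∣q = subst (p * product ps ∣_) (sym n≡qΠ) (*-monoˡ-∣ (product ps) p∣q)
...   | inj₂ p∣Π = ⊥-elim (All¬⇒¬Any p∉ps (factorisationHasAllPrimeFactors pp p∣Π pps))

rad∣ : ∀ m → PrimeDivisorsIn m (_∣ n) → rad m ∣ n
rad∣ m ⊆n = uniquePrimes⇒product∣ _ (filter⁺ P? (upTo⁺ (suc m)))
  (All.map proj₁ candidates) (All.map (λ (pp , p∣m) → ⊆n pp p∣m) candidates)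
  where
  P? : Decidable (λ p → Prime p × p ∣ m)
  P? p = prime? p ×-dec (p ∣? m)
  candidates : All (λ p → Prime p × p ∣ m) (filter P? (upTo (suc m)))
  candidates = all-filter P? (upTo (suc m))

vertex⇒<n : ∀ {t} → 2 ≤ n → Vertex n t → t < n
vertex⇒<n {n} 2≤n (_ , _ , t≤n∸2) = ≤-<-trans t≤n∸2 (∸-monoʳ-< {n} {2} {0} z<s 2≤n)

vertex-∣ : ∀ {t} → 2 ≤ n → Vertex n t → Prime p → p ∣ n ∸ t → Vertex n p
vertex-∣ {n} 2≤n t-vertex@(_ , 2≤t , _) pp p∣n∸t =
  pp , prime⇒≥2 pp ,
  ≤-trans (∣⇒≤ {{>-nonZero (m<n⇒0<n∸m (vertex⇒<n 2≤n t-vertex))}} p∣n∸t) (∸-monoʳ-≤ n 2≤t)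

module TwinComponent {n} {U : Pred ℕ 0ℓ} (2≤n : 2 ≤ n) (component : AutonomousComponent n U)
                     {u v} (u≢v : u ≢ v) (U≡uv : InducedBy U u v) where

  open Equivalence
  private
    U⊆V : ∀ x → U x → Vertex n x
    U⊆V = proj₁ (proj₁ component)
    closed : ∀ s t → Arc n s t → U t → U s
    closed = proj₂ (proj₁ component)
    minimal : ∀ W → Closed n W → NonEmpty W → (∀ x → W x → U x) → ∀ x → U x → W x
    minimal = proj₂ (proj₂ component)

  u∈U : U u
  u∈U = from (U≡uv u) (inj₁ refl)

  v∈U : U v
  v∈U = from (U≡uv v) (inj₂ refl)

  prime-u : Prime u
  prime-u = proj₁ (U⊆V u u∈U)

  prime-v : Prime v
  prime-v = proj₁ (U⊆V v v∈U)

  u<n : u < n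
  u<n = vertex⇒<n 2≤n (U⊆V u u∈U)

  v<n : v < n
  v<n = vertex⇒<n 2≤n (U⊆V v v∈U)

  n≡[n∸u]+u : n ≡ n ∸ u + u
  n≡[n∸u]+u = sym (m∸n+n≡m (<⇒≤ u<n))

  n≡[n∸v]+v : n ≡ n ∸ v + v
  n≡[n∸v]+v = sym (m∸n+n≡m (<⇒≤ v<n))

  primeDivisorsIn-U : ∀ {t} → U t → PrimeDivisorsIn (n ∸ t) U
  primeDivisorsIn-U {t} t∈U pp p∣n∸t =
    closed _ t (vertex-∣ 2≤n (U⊆V t t∈U) pp p∣n∸t , U⊆V t t∈U , p∣n∸t) t∈U

  ¬primeDivisorsIn-self : ∀ {w} → U w → ¬ PrimeDivisorsIn (n ∸ w) (_≡ w)
  ¬primeDivisorsIn-self {w} w∈U ⊆w = u≢v (trans (U⊆W u u∈U) (sym (U⊆W v v∈U)))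
    where
    W : Pred ℕ 0ℓ
    W x = x ≡ w
    W-closed : Closed n W
    W-closed = (λ { x refl → U⊆V w w∈U }) ,
               (λ { s t (s-vertex , _ , s∣n∸t) refl → ⊆w (proj₁ s-vertex) s∣n∸t })
    U⊆W : ∀ x → U x → W x
    U⊆W = minimal W W-closed (w , refl) (λ { x refl → w∈U })

  v∣n∸u : v ∣ n ∸ u
  v∣n∸u with v ∣? n ∸ u
  ... | yes v∣n∸u = v∣n∸u
  ... | no  v∤n∸u = ⊥-elim (¬primeDivisorsIn-self u∈U ⊆u)
    where
    ⊆u : PrimeDivisorsIn (n ∸ u) (_≡ u)
    ⊆u pp p∣n∸u with to (U≡uv _) (primeDivisorsIn-U u∈U pp p∣n∸u)
    ... | inj₁ p≡u  = p≡u
    ... | inj₂ refl = ⊥-elim (v∤n∸u p∣n∸u)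

  module _ (u∣n∸v : u ∣ n ∸ v) where

    u∣n⇒u∣v : u ∣ n → u ∣ v
    u∣n⇒u∣v u∣n = ∣m+n∣m⇒∣n (subst (u ∣_) n≡[n∸v]+v u∣n) u∣n∸v

    u≢2 : 2 ∣ n → u ≢ 2
    u≢2 2∣n refl = u≢v (prime∣prime⇒≡ prime-u prime-v (u∣n⇒u∣v 2∣n))

    primeDivisorsIn-n∸u : PrimeDivisorsIn (n ∸ u) (_≡ v)
    primeDivisorsIn-n∸u pp p∣n∸u with to (U≡uv _) (primeDivisorsIn-U u∈U pp p∣n∸u)
    ... | inj₂ p≡v = p≡v
    ... | inj₁ refl =
      ⊥-elim (u≢v (prime∣prime⇒≡ prime-u prime-v (u∣n⇒u∣v (∣m∸n∣n⇒∣m u (<⇒≤ u<n) p∣n∸u ∣-refl))))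

    n≡v^b+u : ¬ GAC n U → ∃ λ b → 2 ≤ b × n ≡ v ^ b + u
    n≡v^b+u ¬gac with primeDivisorsIn≡⇒power (n ∸ u) {{>-nonZero (m<n⇒0<n∸m u<n)}} primeDivisorsIn-n∸u
    ... | 0 , n∸u≡1 = ⊥-elim (prime⇒≢1 prime-v (∣1⇒≡1 (subst (v ∣_) n∸u≡1 v∣n∸u)))
    ... | 1 , n∸u≡v = ⊥-elim (¬gac (component , u , v , u+v≡n , U≡uv))
      where
      u+v≡n : u + v ≡ n
      u+v≡n = sym (trans n≡[n∸u]+u (trans (cong (_+ u) (trans n∸u≡v (*-identityʳ v))) (+-comm v u)))
    ... | b@(2+ _) , n∸u≡v^b = b , s≤s (s≤s z≤n) , trans n≡[n∸u]+u (cong (_+ u) n∸u≡v^b)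

record PowerSplitting (n : ℕ) : Set where
  field
    {u v b c} : ℕ
    prime-u   : Prime u
    prime-v   : Prime v
    u≢2       : u ≢ 2
    u<v       : u < v
    2≤b       : 2 ≤ b
    2≤c       : 2 ≤ c
    n≡v^b+u   : n ≡ v ^ b + u
    n≡u^c+v   : n ≡ u ^ c + v

inducedBy-swap : ∀ {U u v} → InducedBy U u v → InducedBy U v u
inducedBy-swap U≡uv x = mk⇔ (swap ∘ to (U≡uv x)) (from (U≡uv x) ∘ swap)
  where open Equivalence

orderedTwin⇒powerSplitting : ∀ {U u v} → 2 ∣ n → 4 ≤ n → AutonomousComponent n U → ¬ GAC n U →
                             u < v → InducedBy U u v → PowerSplitting n
orderedTwin⇒powerSplitting {n} {u = u} {v} 2∣n 4≤n component ¬gac u<v U≡uv = record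
  { prime-u = Tuv.prime-u ; prime-v = Tuv.prime-v ; u≢2 = Tuv.u≢2 Tvu.v∣n∸u 2∣n ; u<v = u<v
  ; 2≤b = proj₁ (proj₂ b) ; 2≤c = proj₁ (proj₂ c) ; n≡v^b+u = proj₂ (proj₂ b) ; n≡u^c+v = proj₂ (proj₂ c) }
  where
  2≤n : 2 ≤ n
  2≤n = ≤-trans (s≤s (s≤s z≤n)) 4≤n
  module Tuv = TwinComponent 2≤n component (<⇒≢ u<v) U≡uv
  module Tvu = TwinComponent 2≤n component (<⇒≢ u<v ∘ sym) (inducedBy-swap U≡uv)
  b : ∃ λ b → 2 ≤ b × n ≡ v ^ b + u
  b = Tuv.n≡v^b+u Tvu.v∣n∸u ¬gac
  c : ∃ λ c → 2 ≤ c × n ≡ u ^ c + v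
  c = Tvu.n≡v^b+u Tuv.v∣n∸u ¬gac

twinEAC⇒powerSplitting : ∀ {U} → 2 ∣ n → 4 ≤ n → TwinEAC n U → PowerSplitting n
twinEAC⇒powerSplitting 2∣n 4≤n ((component , _ , ¬gac) , u , v , u≢v , U≡uv) with <-cmp u v
... | tri< u<v _ _ = orderedTwin⇒powerSplitting 2∣n 4≤n component ¬gac u<v U≡uv
... | tri≈ _ u≡v _ = ⊥-elim (u≢v u≡v)
... | tri> _ _ v<u = orderedTwin⇒powerSplitting 2∣n 4≤n component ¬gac v<u (inducedBy-swap U≡uv)

^+<^+ : ∀ {u v b c} → .{{NonZero u}} → u < v → 2 ≤ b → c ≤ b → u ^ c + v < v ^ b + u
^+<^+ {u} {v} {suc k} {c} u<v (s≤s 1≤k) c≤b = begin-strict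
  u ^ c + v               ≤⟨ +-monoˡ-≤ v (^-monoʳ-≤ u c≤b) ⟩
  u * u ^ k + v           ≡⟨ cong (u * u ^ k +_) (sym u+e≡v) ⟩
  u * u ^ k + (u + e)     <⟨ +-mono-≤-< (*-monoʳ-≤ u (^-monoˡ-≤ k (<⇒≤ u<v))) u+e<e*v^k+u ⟩
  u * v ^ k + (e * v ^ k + u) ≡⟨ regroup u e (v ^ k) ⟩
  (u + e) * v ^ k + u     ≡⟨ cong (λ x → x * v ^ k + u) u+e≡v ⟩
  v * v ^ k + u           ∎
  where
  open ≤-Reasoning
  e : ℕ
  e = v ∸ u
  u+e≡v : u + e ≡ v
  u+e≡v = m+[n∸m]≡n (<⇒≤ u<v)
  1<v^k : 1 < v ^ k
  1<v^k = ^-monoʳ-< v (≤-<-trans (>-nonZero⁻¹ u) u<v) 1≤k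
  u+e<e*v^k+u : u + e < e * v ^ k + u
  u+e<e*v^k+u = subst (_< e * v ^ k + u) (+-comm e u)
    (+-monoˡ-< u (m<m*n e (v ^ k) {{>-nonZero (m<n⇒0<n∸m u<v)}} 1<v^k))
  regroup : ∀ u e T → u * T + (e * T + u) ≡ (u + e) * T + u
  regroup = solve-∀

prime∣*⇒∣ : ∀ {v a b} → Prime v → .{{NonZero a}} → .{{NonZero b}} → a < v → b < v →
            v ∣ a * b * k → v ∣ k
prime∣*⇒∣ {k} {v} {a} {b} pv a<v b<v v∣abk with euclidsLemma (a * b) k pv v∣abk
... | inj₂ v∣k  = v∣k
... | inj₁ v∣ab = ⊥-elim ([ ∤ a<v , ∤ b<v ]′ (euclidsLemma a b pv v∣ab))
  where
  ∤ : ∀ {x} → .{{NonZero x}} → x < v → ¬ v ∣ x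
  ∤ x<v v∣x = <⇒≱ x<v (∣⇒≤ v∣x)

v²+u≡P+u+v⇒v²≡P+v : ∀ {u v P} → v ^ 2 + u ≡ P + u + v → v ^ 2 ≡ P + v
v²+u≡P+u+v⇒v²≡P+v {u} {v} {P} eq = +-cancelʳ-≡ u _ _ (trans eq (swap-last P u v))
  where
  swap-last : ∀ P u v → P + u + v ≡ P + v + u
  swap-last = solve-∀

v²≡P+v⇒v∣P : ∀ {v P} → v ^ 2 ≡ P + v → v ∣ P
v²≡P+v⇒v∣P {v} {P} v²≡P+v =
  ∣m+n∣m⇒∣n (subst (v ∣_) (trans v²≡P+v (+-comm P v)) (m∣m*n (v * 1))) ∣-refl

no-solution[2,3] : ∀ {u v} → 3 ≤ u → Prime v → u < v → v ^ 2 + u ≢ u ^ 3 + v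
-- v² − v = (u − 1) u (u + 1) forces v = u + 1, and then v² − v < u³ − u.
no-solution[2,3] {u@(suc (suc (suc t)))} {v} (s≤s (s≤s (s≤s _))) pv u<v eq =
  m+1+n≢m _ (trans (sym (gap t)) (sym (subst (λ x → x ^ 2 + u ≡ u ^ 3 + x) v≡u+1 eq)))
  where
  u³≡ : u ^ 3 ≡ (2 + t) * (3 + t) * (4 + t) + u
  u³≡ = solve 1 (λ t → (con 3 :+ t) :^ 3 := (con 2 :+ t) :* (con 3 :+ t) :* (con 4 :+ t) :+ (con 3 :+ t)) refl t
  v∣u+1 : v ∣ 4 + t
  v∣u+1 = prime∣*⇒∣ pv (≤-trans (n≤1+n _) u<v) u<v
    (v²≡P+v⇒v∣P (v²+u≡P+u+v⇒v²≡P+v {u} {v} (trans eq (cong (_+ v) u³≡))))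
  v≡u+1 : v ≡ 4 + t
  v≡u+1 = ≤-antisym (∣⇒≤ v∣u+1) u<v
  gap : ∀ t → (3 + t) ^ 3 + (4 + t) ≡ ((4 + t) ^ 2 + (3 + t)) + suc (t * t * t + 8 * t * t + 19 * t + 11)
  gap = solve 1 (λ t → (con 3 :+ t) :^ 3 :+ (con 4 :+ t) :=
                       ((con 4 :+ t) :^ 2 :+ (con 3 :+ t)) :+ (con 1 :+ (t :* t :* t :+ con 8 :* t :* t :+ con 19 :* t :+ con 11))) refl

u²+u+1≢m[a*m+1] : ∀ t m → (3 + t) * (3 + t) + (3 + t) + 1 ≢ m * ((2 + t) * (3 + t) * m + 1)
u²+u+1≢m[a*m+1] t 0 ()
u²+u+1≢m[a*m+1] t 1 eq = m+1+n≢m _ (trans (sym (gap t)) eq)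
  where
  gap : ∀ t → (3 + t) * (3 + t) + (3 + t) + 1 ≡ 1 * ((2 + t) * (3 + t) * 1 + 1) + suc (2 * t + 5)
  gap = solve-∀
u²+u+1≢m[a*m+1] t (suc (suc k)) eq = m+1+n≢m _ (trans (sym (gap t k)) (sym eq))
  where
  gap : ∀ t k → (2 + k) * ((2 + t) * (3 + t) * (2 + k) + 1) ≡
                ((3 + t) * (3 + t) + (3 + t) + 1) + suc (3 * t * t + 13 * t + 12 + k + k * (k + 4) * (t + 2) * (t + 3))
  gap = solve-∀

no-solution[2,4] : ∀ {u v} → 3 ≤ u → Prime v → u < v → v ^ 2 + u ≢ u ^ 4 + v
-- v² − v = (u² − u)(u² + u + 1) forces u² + u + 1 = q v with v = (u² − u) q + 1,
-- which has no solution q.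
no-solution[2,4] {u@(suc (suc (suc t)))} {v} (s≤s (s≤s (s≤s _))) pv u<v eq =
  u²+u+1≢m[a*m+1] t q (trans S≡q*v (cong (q *_) v≡a*q+1))
  where
  a S : ℕ
  a = (2 + t) * (3 + t)
  S = (3 + t) * (3 + t) + (3 + t) + 1
  u⁴≡ : u ^ 4 ≡ a * S + u
  u⁴≡ = solve 1 (λ t → (con 3 :+ t) :^ 4 :=
                  (con 2 :+ t) :* (con 3 :+ t) :* ((con 3 :+ t) :* (con 3 :+ t) :+ (con 3 :+ t) :+ con 1) :+ (con 3 :+ t)) refl t
  v²≡aS+v : v ^ 2 ≡ a * S + v
  v²≡aS+v = v²+u≡P+u+v⇒v²≡P+v {u} {v} (trans eq (cong (_+ v) u⁴≡))
  v∣S : v ∣ S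
  v∣S = prime∣*⇒∣ pv (≤-trans (n≤1+n _) u<v) u<v (v²≡P+v⇒v∣P v²≡aS+v)
  q : ℕ
  q = quotient v∣S
  S≡q*v : S ≡ q * v
  S≡q*v = m∣n⇒n≡quotient*m v∣S
  instance _ = prime⇒nonZero pv
  v≡a*q+1 : v ≡ a * q + 1
  v≡a*q+1 = *-cancelʳ-≡ v (a * q + 1) v (begin
    v * v                 ≡⟨ cong (v *_) (sym (*-identityʳ v)) ⟩
    v ^ 2                 ≡⟨ v²≡aS+v ⟩
    a * S + v             ≡⟨ cong (λ x → a * x + v) S≡q*v ⟩
    a * (q * v) + v       ≡⟨ factor a q v ⟩
    (a * q + 1) * v       ∎)
    where
    open ≡-Reasoning
    factor : ∀ a m v → a * (m * v) + v ≡ (a * m + 1) * v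
    factor = solve-∀

ABCBound : ℕ → ℕ → ℕ → Set
ABCBound p q B = ∀ (a b c : ℕ) → 0 < a → 0 < b → a + b ≡ c → Coprime a b →
                 rad (a * b * c) ^ (q + p) < c ^ q → c < B

abc₁₁-margin : ∀ {r u v b c} → .{{NonZero u}} → r ≤ u * v * v → u < v → 3 ≤ b → b < c → u ^ c < v ^ b →
               r ^ 12 < (v ^ b) ^ 11
abc₁₁-margin {r} {u} {v} {3} {c} r≤uvv u<v _ 3<c u^c<v³ = begin-strict
  r ^ 12                ≤⟨ ^-monoˡ-≤ 12 r≤uvv ⟩
  (u * v * v) ^ 12      ≡⟨ solve 2 (λ u v → (u :* v :* v) :^ 12 := (u :^ 4) :^ 3 :* v :^ 24) refl u v ⟩
  (u ^ 4) ^ 3 * v ^ 24  <⟨ *-monoˡ-< (v ^ 24) {{m^n≢0 v 24}} (^-monoˡ-< 3 u⁴<v³) ⟩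
  (v ^ 3) ^ 3 * v ^ 24  ≡⟨ solve 1 (λ v → (v :^ 3) :^ 3 :* v :^ 24 := (v :^ 3) :^ 11) refl v ⟩
  (v ^ 3) ^ 11          ∎
  where
  open ≤-Reasoning
  instance _ = >-nonZero (m<n⇒0<n u<v)
  u⁴<v³ : u ^ 4 < v ^ 3
  u⁴<v³ = ≤-<-trans (^-monoʳ-≤ u 3<c) u^c<v³
abc₁₁-margin {r} {u} {v} {b@(suc (suc (suc (suc _))))} r≤uvv u<v _ _ _ = begin-strict
  r ^ 12            ≤⟨ ^-monoˡ-≤ 12 r≤uvv ⟩
  (u * v * v) ^ 12  <⟨ ^-monoˡ-< 12 (*-monoˡ-< v (*-monoˡ-< v u<v)) ⟩
  (v * v * v) ^ 12  ≡⟨ solve 1 (λ v → (v :* v :* v) :^ 12 := v :^ 36) refl v ⟩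
  v ^ 36            ≤⟨ ^-monoʳ-≤ v (≤-trans (m≤m+n 36 8) (*-monoˡ-≤ 11 4≤b)) ⟩
  v ^ (b * 11)      ≡⟨ ^-*-assoc v b 11 ⟨
  (v ^ b) ^ 11      ∎
  where
  open ≤-Reasoning
  instance _ = >-nonZero (m<n⇒0<n u<v)
  4≤b : 4 ≤ b
  4≤b = s≤s (s≤s (s≤s (s≤s z≤n)))
abc₁₁-margin {b = 1} _ _ (s≤s ()) _ _
abc₁₁-margin {b = 2} _ _ (s≤s (s≤s ())) _ _

abc₁₁-bound : ∀ {B u v b c} → ABCBound 1 11 B → Prime u → Prime v → u < v → 3 ≤ b → b < c →
              v ^ b + u ≡ u ^ c + v → v ^ b < B
abc₁₁-bound {B} {u} {v} {b} {c} abc pu pv u<v 3≤b b<c eq =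
  abc (u ^ c) (v ∸ u) (v ^ b) (m^n>0 u c) (m<n⇒0<n∸m u<v) u^c+[v∸u]≡v^b coprime quality
  where
  instance
    _ = prime⇒nonZero pu
    _ = prime⇒nonZero pv
  u^c+[v∸u]≡v^b : u ^ c + (v ∸ u) ≡ v ^ b
  u^c+[v∸u]≡v^b = +-cancelʳ-≡ u _ _ (begin
    u ^ c + (v ∸ u) + u    ≡⟨ +-assoc (u ^ c) (v ∸ u) u ⟩
    u ^ c + (v ∸ u + u)    ≡⟨ cong (u ^ c +_) (m∸n+n≡m (<⇒≤ u<v)) ⟩
    u ^ c + v              ≡⟨ eq ⟨
    v ^ b + u              ∎)
    where open ≡-Reasoning
  coprime : Coprime (u ^ c) (v ∸ u)
  coprime = noCommonPrime⇒coprime (u ^ c) (v ∸ u) {{m^n≢0 u c}} λ pp p∣u^c p∣v∸u →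
    let u∣v∸u = subst (_∣ v ∸ u) (primeDivisorsIn-^ c (primeDivisorsIn-prime pu) pp p∣u^c) p∣v∸u
    in <⇒≢ u<v (prime∣prime⇒≡ pu pv (∣m∸n∣n⇒∣m u (<⇒≤ u<v) u∣v∸u ∣-refl))
  K : ℕ
  K = u * v * (v ∸ u)
  rad≤uvv : rad (u ^ c * (v ∸ u) * v ^ b) ≤ u * v * v
  rad≤uvv = ≤-trans (∣⇒≤ {{m*n≢0 (u * v) (v ∸ u) {{m*n≢0 u v}} {{>-nonZero (m<n⇒0<n∸m u<v)}}}} rad∣K)
                    (*-monoʳ-≤ (u * v) (m∸n≤m v u))
    where
    rad∣K : rad (u ^ c * (v ∸ u) * v ^ b) ∣ K
    rad∣K = rad∣ _ (primeDivisorsIn-* (primeDivisorsIn-* ⊆u^c (∣⇒primeDivisorsIn (n∣m*n (u * v)))) ⊆v^b)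
      where
      ⊆u^c : PrimeDivisorsIn (u ^ c) (_∣ K)
      ⊆u^c = primeDivisorsIn-^ c (∣⇒primeDivisorsIn (∣m⇒∣m*n (v ∸ u) (m∣m*n v)))
      ⊆v^b : PrimeDivisorsIn (v ^ b) (_∣ K)
      ⊆v^b = primeDivisorsIn-^ b (∣⇒primeDivisorsIn (n∣m*n*o u (v ∸ u)))
  quality : rad (u ^ c * (v ∸ u) * v ^ b) ^ 12 < (v ^ b) ^ 11
  quality = abc₁₁-margin rad≤uvv u<v 3≤b b<c
    (subst (u ^ c <_) u^c+[v∸u]≡v^b (m<m+n (u ^ c) (m<n⇒0<n∸m u<v)))

abc₁₉-margin : ∀ {r K u X} → .{{NonZero X}} → r ≤ K → u ^ 5 ≤ X → K * K ≤ 512 * u ^ 4 * X → 2 ^ 53 ≤ X →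
               r ^ 20 < (4 * X) ^ 19
abc₁₉-margin {r} {K} {u} {X} r≤K u⁵≤X K²≤ 2⁵³≤X = begin-strict
  r ^ 20                          ≤⟨ ^-monoˡ-≤ 20 r≤K ⟩
  K ^ 20                          ≡⟨ square K ⟩
  (K * K) ^ 10                    ≤⟨ ^-monoˡ-≤ 10 K²≤ ⟩
  (512 * u ^ 4 * X) ^ 10          ≡⟨ expand 512 u X ⟩
  512 ^ 10 * (u ^ 5) ^ 8 * X ^ 10 ≤⟨ *-monoˡ-≤ (X ^ 10) (*-monoʳ-≤ (512 ^ 10) (^-monoˡ-≤ 8 u⁵≤X)) ⟩
  512 ^ 10 * X ^ 8 * X ^ 10       ≡⟨ collect (512 ^ 10) X ⟩
  512 ^ 10 * X ^ 18               <⟨ *-monoˡ-< (X ^ 18) {{m^n≢0 X 18}} 512¹⁰<4¹⁹X ⟩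
  4 ^ 19 * X * X ^ 18             ≡⟨ factor 4 X ⟩
  (4 * X) ^ 19                    ∎
  where
  open ≤-Reasoning
  -- the threshold 2⁵³ comes from 512¹⁰ = 2⁹⁰ < 2⁹¹ = 4¹⁹ · 2⁵³
  512¹⁰<4¹⁹X : 512 ^ 10 < 4 ^ 19 * X
  512¹⁰<4¹⁹X = <-≤-trans (<ᵇ⇒< (512 ^ 10) (4 ^ 19 * 2 ^ 53) _) (*-monoʳ-≤ (4 ^ 19) 2⁵³≤X)
  square : ∀ K → K ^ 20 ≡ (K * K) ^ 10
  square = solve 1 (λ K → K :^ 20 := (K :* K) :^ 10) refl
  expand : ∀ c u X → (c * u ^ 4 * X) ^ 10 ≡ c ^ 10 * (u ^ 5) ^ 8 * X ^ 10
  expand = solve 3 (λ c u X → (c :* u :^ 4 :* X) :^ 10 := c :^ 10 :* (u :^ 5) :^ 8 :* X :^ 10) refl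
  collect : ∀ c X → c * X ^ 8 * X ^ 10 ≡ c * X ^ 18
  collect = solve 2 (λ c X → c :* X :^ 8 :* X :^ 10 := c :* X :^ 18) refl
  factor : ∀ c X → c ^ 19 * X * X ^ 18 ≡ (c * X) ^ 19
  factor = solve 2 (λ c X → c :^ 19 :* X :* X :^ 18 := (c :* X) :^ 19) refl

module ABC₁₉Triple {w y c} (pu : Prime (suc w)) (X≡ : suc w ^ c ≡ y * y + y + w + 1) where

  private
    u v : ℕ
    u = suc w
    v = suc y

  X a o d K : ℕ
  X = u ^ c
  -- a = 4u − 1 and o = 2v − 1, written without truncated subtraction
  a = 3 + 4 * w
  o = 1 + 2 * y
  d = o * o
  K = 2 * u * o * a

  a+d≡4X : a + d ≡ 4 * X
  a+d≡4X = trans (shape y w) (cong (4 *_) (sym X≡))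
    where
    shape : ∀ y w → (3 + 4 * w) + (1 + 2 * y) * (1 + 2 * y) ≡ 4 * (y * y + y + w + 1)
    shape = solve-∀
  v²≤2X : v ^ 2 ≤ 2 * X
  v²≤2X = subst (v ^ 2 ≤_) (trans (shape y w) (cong (2 *_) (sym X≡))) (m≤m+n (v ^ 2) _)
    where
    shape : ∀ y w → (1 + y) ^ 2 + (y * y + 2 * w + 1) ≡ 2 * (y * y + y + w + 1)
    shape = solve 2 (λ y w → (con 1 :+ y) :^ 2 :+ (y :* y :+ con 2 :* w :+ con 1) := con 2 :* (y :* y :+ y :+ w :+ con 1)) refl
  a+1≡4u : a + 1 ≡ 4 * u
  a+1≡4u = shape w
    where
    shape : ∀ w → 3 + 4 * w + 1 ≡ 4 * (1 + w)
    shape = solve-∀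
  primeDivisorsIn-4X : PrimeDivisorsIn (4 * X) (_∣ 4 * u)
  primeDivisorsIn-4X = primeDivisorsIn-* (primeDivisorsIn-^ {m = 2} 2 (∣⇒primeDivisorsIn (∣m⇒∣m*n u (divides 2 refl))))
                                         (primeDivisorsIn-^ c (∣⇒primeDivisorsIn (n∣m*n 4)))
  coprime : Coprime a d
  coprime = noCommonPrime⇒coprime a d λ {p} pp p∣a p∣d →
    let p∣4u = primeDivisorsIn-4X pp (subst (p ∣_) a+d≡4X (∣m∣n⇒∣m+n p∣a p∣d))
    in prime⇒≢1 pp (∣1⇒≡1 (∣m+n∣m⇒∣n (subst (p ∣_) (sym a+1≡4u) p∣4u) p∣a))
  rad≤K : rad (a * d * (4 * X)) ≤ K
  rad≤K = ∣⇒≤ (rad∣ _ (primeDivisorsIn-* (primeDivisorsIn-* (∣⇒primeDivisorsIn (n∣m*n (2 * u * o))) ⊆o²) ⊆4X))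
    where
    o∣K : o ∣ K
    o∣K = ∣m⇒∣m*n a (n∣m*n (2 * u))
    ⊆o² : PrimeDivisorsIn d (_∣ K)
    ⊆o² = primeDivisorsIn-* (∣⇒primeDivisorsIn o∣K) (∣⇒primeDivisorsIn o∣K)
    ⊆4X : PrimeDivisorsIn (4 * X) (_∣ K)
    ⊆4X = primeDivisorsIn-* (primeDivisorsIn-^ {m = 2} 2 (∣⇒primeDivisorsIn (∣m⇒∣m*n a (∣m⇒∣m*n o (m∣m*n u)))))
                            (primeDivisorsIn-^ c (∣⇒primeDivisorsIn (∣m⇒∣m*n a (∣m⇒∣m*n o (n∣m*n 2)))))
  K²≤ : K * K ≤ 512 * u ^ 4 * X
  K²≤ = begin
    K * K                                         ≤⟨ *-mono-≤ K≤ K≤ ⟩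
    (2 * u * (2 * v) * (4 * u)) * (2 * u * (2 * v) * (4 * u)) ≡⟨ expand u v ⟩
    256 * u ^ 4 * v ^ 2                           ≤⟨ *-monoʳ-≤ (256 * u ^ 4) v²≤2X ⟩
    256 * u ^ 4 * (2 * X)                         ≡⟨ regroup u X ⟩
    512 * u ^ 4 * X                               ∎
    where
    open ≤-Reasoning
    K≤ : K ≤ 2 * u * (2 * v) * (4 * u)
    K≤ = *-mono-≤ (*-monoʳ-≤ (2 * u) (subst (o ≤_) (sym (shape y)) (m≤m+n o 1))) (subst (a ≤_) a+1≡4u (m≤m+n a 1))
      where
      shape : ∀ y → 2 * (1 + y) ≡ 1 + 2 * y + 1
      shape = solve-∀
    expand : ∀ u v → (2 * u * (2 * v) * (4 * u)) * (2 * u * (2 * v) * (4 * u)) ≡ 256 * u ^ 4 * v ^ 2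
    expand = solve 2 (λ u v → (con 2 :* u :* (con 2 :* v) :* (con 4 :* u)) :* (con 2 :* u :* (con 2 :* v) :* (con 4 :* u))
                              := con 256 :* u :^ 4 :* v :^ 2) refl
    regroup : ∀ u X → 256 * u ^ 4 * (2 * X) ≡ 512 * u ^ 4 * X
    regroup = solve 2 (λ u X → con 256 :* u :^ 4 :* (con 2 :* X) := con 512 :* u :^ 4 :* X) refl

abc₁₉-bound : ∀ {B u v c} → ABCBound 1 19 B → Prime u → u < v → 5 ≤ c →
              v ^ 2 + u ≡ u ^ c + v → v ^ 2 < B + 2 ^ 54
abc₁₉-bound {B} {u@(suc w)} {v@(suc y)} {c} abc pu u<v 5≤c eq = bound (2 ^ 53 ≤? X)
  where
  X≡ : u ^ c ≡ y * y + y + w + 1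
  X≡ = +-cancelʳ-≡ v _ _ (trans (sym eq) (shape y w))
    where
    shape : ∀ y w → (1 + y) ^ 2 + (1 + w) ≡ y * y + y + w + 1 + (1 + y)
    shape = solve 2 (λ y w → (con 1 :+ y) :^ 2 :+ (con 1 :+ w) := y :* y :+ y :+ w :+ con 1 :+ (con 1 :+ y)) refl
  open ABC₁₉Triple {w} {y} {c} pu X≡
  instance _ = m^n≢0 u c
  quality : 2 ^ 53 ≤ X → rad (a * d * (4 * X)) ^ 20 < (4 * X) ^ 19
  quality 2⁵³≤X = abc₁₉-margin {rad (a * d * (4 * X))} {K} {u} {X} rad≤K (^-monoʳ-≤ u 5≤c) K²≤ 2⁵³≤X
  bound : Dec (2 ^ 53 ≤ X) → v ^ 2 < B + 2 ^ 54
  bound (yes 2⁵³≤X) = <-≤-trans (≤-<-trans (≤-trans v²≤2X (*-monoˡ-≤ X {2} {4} (s≤s (s≤s z≤n))))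
                                           (abc a d (4 * X) z<s z<s a+d≡4X coprime (quality 2⁵³≤X)))
                                (m≤m+n B _)
  bound (no 2⁵³≰X) = <-≤-trans (≤-<-trans v²≤2X (*-monoʳ-< 2 (≰⇒> 2⁵³≰X))) (m≤n+m _ B)

abc⇒v^b-bounded : ∀ {B₁ B₂ u v b c} → ABCBound 1 11 B₁ → ABCBound 1 19 B₂ →
                  Prime u → Prime v → 3 ≤ u → u < v → 2 ≤ b → b < c →
                  v ^ b + u ≡ u ^ c + v → v ^ b < B₁ + (B₂ + 2 ^ 54)
abc⇒v^b-bounded {b = 2} {c = 3} _ _ _ pv 3≤u u<v _ _ eq = ⊥-elim (no-solution[2,3] 3≤u pv u<v eq)
abc⇒v^b-bounded {b = 2} {c = 4} _ _ _ pv 3≤u u<v _ _ eq = ⊥-elim (no-solution[2,4] 3≤u pv u<v eq)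
abc⇒v^b-bounded {B₁} {b = 2} {c = c@(suc (suc (suc (suc (suc _)))))} _ abc₁₉ pu _ _ u<v _ _ eq =
  <-≤-trans (abc₁₉-bound {c = c} abc₁₉ pu u<v (s≤s (s≤s (s≤s (s≤s (s≤s z≤n))))) eq) (m≤n+m _ B₁)
abc⇒v^b-bounded {B₁} {b = suc (suc (suc _))} abc₁₁ _ pu pv _ u<v _ b<c eq =
  <-≤-trans (abc₁₁-bound abc₁₁ pu pv u<v (s≤s (s≤s (s≤s z≤n))) b<c eq) (m≤m+n B₁ _)
abc⇒v^b-bounded {b = 2} {c = 0} _ _ _ _ _ _ _ () _
abc⇒v^b-bounded {b = 2} {c = 1} _ _ _ _ _ _ _ (s≤s ()) _
abc⇒v^b-bounded {b = 2} {c = 2} _ _ _ _ _ _ _ (s≤s (s≤s ())) _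
abc⇒v^b-bounded {b = 0} _ _ _ _ _ _ () _ _
abc⇒v^b-bounded {b = 1} _ _ _ _ _ _ (s≤s ()) _ _

abc⇒powerSplitting-bounded : ABC → ∃ λ N → ∀ {n} → PowerSplitting n → n < N
abc⇒powerSplitting-bounded abc with abc 1 11 z<s z<s | abc 1 19 z<s z<s
... | B₁ , abc₁₁ | B₂ , abc₁₉ = M + M , n<M+M
  where
  M : ℕ
  M = B₁ + (B₂ + 2 ^ 54)
  n<M+M : ∀ {n} → PowerSplitting n → n < M + M
  n<M+M {n} s = subst (_< M + M) (sym n≡v^b+u) (+-mono-< v^b<M (<-≤-trans u<v (≤-trans v≤v^b (<⇒≤ v^b<M))))
    where
    open PowerSplitting s
    instance _ = prime⇒nonZero prime-u
    instance _ = prime⇒nonZero prime-v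
    eq : v ^ b + u ≡ u ^ c + v
    eq = trans (sym n≡v^b+u) n≡u^c+v
    b<c : b < c
    b<c = ≰⇒> λ c≤b → <⇒≢ (^+<^+ u<v 2≤b c≤b) (sym eq)
    v^b<M : v ^ b < M
    v^b<M = abc⇒v^b-bounded abc₁₁ abc₁₉ prime-u prime-v (≤∧≢⇒< (prime⇒≥2 prime-u) (u≢2 ∘ sym))
                            u<v 2≤b b<c eq
    v≤v^b : v ≤ v ^ b
    v≤v^b = subst (_≤ v ^ b) (*-identityʳ v) (^-monoʳ-≤ v (≤-trans (s≤s z≤n) 2≤b))

corollary3 : ABC →
    ∃ λ N → ∀ (n : ℕ) (U : Pred ℕ 0ℓ) → 2 ∣ n → 4 ≤ n → TwinEAC n U → n < N
corollary3 abc with abc⇒powerSplitting-bounded abc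
... | N , bounded = N , λ n U 2∣n 4≤n twin → bounded (twinEAC⇒powerSplitting 2∣n 4≤n twin)
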